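{- There is a function $F:\mathbb{N}\to\mathbb{N}$ such that, if $G$ is a finite group of even order which has exactly $n$ involutions and $|G|\ge F(n)$, then the commuting graph $\mathrm{Com}(G)$ of $G$ has a perfect matching.
   Context: The commuting graph $\mathrm{Com}(G)$ of a finite group $G$ is the simple undirected graph with vertex set $G$ in which distinct $x,y$ are adjacent iff $xy=yx$. A perfect matching is a set of pairwise vertex-disjoint edges covering every vertex. -}

module Defs where

open import Data.Nat using (ℕ)
open import Data.Fin using (Fin)
open import Data.Fin.Properties using (_≟_)
open import Data.List using (List; length; filter; lookup)
open import Data.List.Relation.Unary.All using (All)
open import Data.List.Relation.Unary.Any using (Any)
open import Data.Fin using () renaming (Fin to F)
open import Data.Product using (Σ; _×_; proj₁; proj₂; _,_)
open import Data.Sum using (_⊎_)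
open import Relation.Nullary using (¬_; Dec; yes; no)
open import Relation.Nullary.Decidable using (_×-dec_; ¬?)
open import Relation.Binary.PropositionalEquality using (_≡_)
open import Data.List using (allFin)

-- A finite group of order m is represented by a group structure on Fin m
-- (with propositional equality), via stdlib's IsGroup (see Statement).

Op₂ : ℕ → Set
Op₂ m = Fin m → Fin m → Fin m

IsInvolution : {m : ℕ} → Op₂ m → Fin m → Fin m → Set
IsInvolution _∙_ e x = ¬ (x ≡ e) × (x ∙ x ≡ e)

isInvolution? : {m : ℕ} (_∙_ : Op₂ m) (e : Fin m) (x : Fin m) → Dec (IsInvolution _∙_ e x)
isInvolution? _∙_ e x = ¬? (x ≟ e) ×-dec ((x ∙ x) ≟ e)

numInvolutions : {m : ℕ} → Op₂ m → Fin m → ℕ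
numInvolutions {m} _∙_ e = length (filter (isInvolution? _∙_ e) (allFin m))

IsComEdge : {m : ℕ} → Op₂ m → Fin m × Fin m → Set
IsComEdge _∙_ (x , y) = ¬ (x ≡ y) × (x ∙ y ≡ y ∙ x)

Incident : {m : ℕ} → Fin m → Fin m × Fin m → Set
Incident v (x , y) = (v ≡ x) ⊎ (v ≡ y)

VertexDisjoint : {m : ℕ} → Fin m × Fin m → Fin m × Fin m → Set
VertexDisjoint (x , y) (u , w) =
  ¬ (x ≡ u) × ¬ (x ≡ w) × ¬ (y ≡ u) × ¬ (y ≡ w)

PerfectMatchingCom : (m : ℕ) → Op₂ m → Set
PerfectMatchingCom m _∙_ =
  Σ (List (Fin m × Fin m)) λ M →
    All (IsComEdge _∙_) M
    × (∀ (i j : Fin (length M)) → ¬ (i ≡ j) → VertexDisjoint (lookup M i) (lookup M j))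
    × (∀ (v : Fin m) → Any (Incident v) M)

-- Let S be the set of self-inverse elements: the identity and the n involutions.
-- Elements outside S are matched with their inverses, and the elements of S are matched
-- in pairs t, s with y and y⁻¹, where y ∉ S commutes with both t and s.  Such y abound
-- once |G| > 3|S|³: conjugation permutes S, so by pigeonhole more than 3|S| elements g
-- conjugate t and s to the same pair, and for a fixed such a the elements a⁻¹g centralise
-- both t and s.  That leaves room to avoid S and the at most 2|S| vertices matched so far.
-- A single unmatched element of S cannot remain because |G| is even.

module Submission where

open import Defs
open import Algebra.Bundles using (Group)
open import Algebra.Structures using (IsGroup)
import Algebra.Properties.Group as GroupProperties
open import Data.Bool using (true; false)
open import Data.Fin using (Fin; zero; suc)
open import Data.Fin.Properties using (_≟_)
open import Data.List using (List; []; _∷_; length; filter; lookup; map; _++_; allFin)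
open import Data.List.Properties using (filter-notAll; length-map; length-++; length-tabulate)
open import Data.List.Membership.Propositional using (_∈_; _∉_; find)
open import Data.List.Membership.Propositional.Properties
  using (∈-filter⁺; ∈-filter⁻; ∈-allFin; ∈-++⁺ˡ; ∈-++⁺ʳ)
open import Data.List.Relation.Binary.Subset.Propositional using (_⊆_)
import Data.List.Relation.Binary.Sublist.Propositional.Properties as Sublist
open import Data.List.Relation.Unary.All as All using (All; []; _∷_; all?)
open import Data.List.Relation.Unary.All.Properties
  using (¬All⇒Any¬; ¬Any⇒All¬; All¬⇒¬Any; all-filter; map⁺)
  renaming (filter⁺ to All-filter⁺)
import Data.List.Relation.Unary.AllPairs as AllPairs
open import Data.List.Relation.Unary.Any as Any using (Any; here; there)
open import Data.List.Relation.Unary.Unique.Propositional using (Unique; []; _∷_)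
open import Data.List.Relation.Unary.Unique.Propositional.Properties using (allFin⁺)
  renaming (filter⁺ to Unique-filter⁺; map⁺ to Unique-map⁺)
open import Data.Nat using (ℕ; suc; _+_; _*_; _≤_; _<_; _<?_; z≤n)
open import Data.Nat.Divisibility using (_∣_; divides)
open import Data.Nat.Tactic.RingSolver using (solve-∀)
open import Data.Nat.Properties
  using (≤-<-trans; <-≤-trans; ≤-trans; ≤-reflexive; ≤-antisym; <⇒≱; ≮⇒≥; n≮0; m≤m+n;
         +-suc; *-suc; *-comm; +-cancelˡ-<; +-monoˡ-≤; +-monoʳ-≤; even≢odd; module ≤-Reasoning)
open import Data.Product using (Σ; ∃; ∃₂; _×_; _,_; proj₁; proj₂)
open import Data.Sum using (_⊎_; inj₁; inj₂; [_,_]; map₂)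
open import Function using (_∘_; id)
open import Level using (0ℓ)
open import Relation.Binary.Definitions using (DecidableEquality)
open import Relation.Binary.PropositionalEquality
  using (_≡_; _≢_; refl; sym; trans; cong; subst; module ≡-Reasoning)
open import Relation.Nullary using (¬_; yes; no; does; contradiction)
open import Relation.Nullary.Decidable using (¬?; _⊎-dec_)
open import Relation.Unary using (Pred; Decidable)

module _ {a} {A : Set a} where

  module _ {p} {P : Pred A p} (P? : Decidable P) where

    length-filter+filter-¬ : ∀ xs → length xs ≡ length (filter P? xs) + length (filter (¬? ∘ P?) xs)
    length-filter+filter-¬ [] = refl
    length-filter+filter-¬ (x ∷ xs) with does (P? x)
    ... | true = cong suc (length-filter+filter-¬ xs)
    ... | false = trans (cong suc (length-filter+filter-¬ xs)) (sym (+-suc _ _))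

  ∉⇒≢ : ∀ {x y : A} {xs} → x ∉ xs → y ∈ xs → x ≢ y
  ∉⇒≢ x∉xs y∈xs refl = x∉xs y∈xs

  module _ (_≟_ : DecidableEquality A) where

    open import Data.List.Membership.DecPropositional _≟_ using (_∈?_)

    Unique-⊆⇒length≤ : ∀ {xs ys : List A} → Unique xs → xs ⊆ ys → length xs ≤ length ys
    Unique-⊆⇒length≤ {[]} _ _ = z≤n
    Unique-⊆⇒length≤ {x ∷ xs} {ys} (x≢xs ∷ u) x∷xs⊆ys =
      ≤-<-trans (Unique-⊆⇒length≤ u xs⊆ys-x)
                (filter-notAll (¬? ∘ (x ≟_)) ys (Any.map (λ x≡y x≢y → x≢y x≡y) x∈ys))
      where
      x∈ys : x ∈ ys
      x∈ys = x∷xs⊆ys (here refl)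
      xs⊆ys-x : xs ⊆ filter (¬? ∘ (x ≟_)) ys
      xs⊆ys-x z∈xs = ∈-filter⁺ (¬? ∘ (x ≟_)) (x∷xs⊆ys (there z∈xs)) (All.lookup x≢xs z∈xs)

    length<⇒∃∉ : ∀ {xs ys : List A} → Unique ys → length xs < length ys → ∃ λ y → y ∈ ys × y ∉ xs
    length<⇒∃∉ {xs} {ys} u lt with all? (_∈? xs) ys
    ... | yes ys⊆xs = contradiction (Unique-⊆⇒length≤ u (All.lookup ys⊆xs)) (<⇒≱ lt)
    ... | no ys⊈xs = find (¬All⇒Any¬ (_∈? xs) ys ys⊈xs)

length-allFin : ∀ m → length (allFin m) ≡ m
length-allFin m = length-tabulate id

Unique-complete⇒length≡ : ∀ {m} {xs : List (Fin m)} → Unique xs → (∀ x → x ∈ xs) → length xs ≡ m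
Unique-complete⇒length≡ {m} u complete = ≤-antisym
  (≤-trans (Unique-⊆⇒length≤ _≟_ u (λ {x} _ → ∈-allFin x)) (≤-reflexive (length-allFin m)))
  (≤-trans (≤-reflexive (sym (length-allFin m)))
           (Unique-⊆⇒length≤ _≟_ (allFin⁺ m) (λ {x} _ → complete x)))

module _ {a b} {A : Set a} {B : Set b} (_≟_ : DecidableEquality B) (f : A → B) where

  fibre : B → List A → List A
  fibre y = filter (λ x → f x ≟ y)

  pigeonhole : ∀ k (ys : List B) (xs : List A) → (∀ {x} → x ∈ xs → f x ∈ ys) →
               k * length ys < length xs → ∃ λ y → k < length (fibre y xs)
  pigeonhole k [] [] _ lt = contradiction lt n≮0
  pigeonhole k [] (x ∷ xs) f∈[] _ with f∈[] (here refl)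
  ... | ()
  pigeonhole k (y ∷ ys) xs f∈ lt with k <? length (fibre y xs)
  ... | yes big = y , big
  ... | no small =
    let z , big = pigeonhole k ys rest f∈ys (+-cancelˡ-< k _ _ rest-large)
    in z , <-≤-trans big (fibre-rest≤fibre z)
    where
    rest : List A
    rest = filter (λ x → ¬? (f x ≟ y)) xs
    f∈ys : ∀ {x} → x ∈ rest → f x ∈ ys
    f∈ys x∈rest with ∈-filter⁻ (λ x → ¬? (f x ≟ y)) x∈rest
    ... | x∈xs , fx≢y with f∈ x∈xs
    ...   | here fx≡y = contradiction fx≡y fx≢y
    ...   | there fx∈ys = fx∈ys
    open ≤-Reasoning
    rest-large : k + k * length ys < k + length rest
    rest-large = begin-strict
      k + k * length ys                  ≡⟨ *-suc k (length ys) ⟨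
      k * length (y ∷ ys)                <⟨ lt ⟩
      length xs                          ≡⟨ length-filter+filter-¬ (λ x → f x ≟ y) xs ⟩
      length (fibre y xs) + length rest  ≤⟨ +-monoˡ-≤ (length rest) (≮⇒≥ small) ⟩
      k + length rest                    ∎
    fibre-rest≤fibre : ∀ z → length (fibre z rest) ≤ length (fibre z xs)
    fibre-rest≤fibre z = Sublist.length-mono-≤
      (Sublist.filter⁺ (λ x → f x ≟ z) (λ x → f x ≟ z) (λ { refl p → p }) (Sublist.filter-⊆ _ xs))

vertices : ∀ {a} {A : Set a} → List (A × A) → List A
vertices [] = []
vertices ((x , y) ∷ M) = x ∷ y ∷ vertices M

length-vertices : ∀ {a} {A : Set a} (M : List (A × A)) → length (vertices M) ≡ 2 * length M
length-vertices [] = refl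
length-vertices (_ ∷ M) = trans (cong (2 +_) (length-vertices M)) (sym (*-suc 2 (length M)))

module _ {m : ℕ} where

  lookup∈vertices : ∀ (M : List (Fin m × Fin m)) i →
                    proj₁ (lookup M i) ∈ vertices M × proj₂ (lookup M i) ∈ vertices M
  lookup∈vertices (_ ∷ M) zero = here refl , there (here refl)
  lookup∈vertices (_ ∷ M) (suc i) with lookup∈vertices M i
  ... | x∈ , y∈ = there (there x∈) , there (there y∈)

  VertexDisjoint-sym : ∀ {p q : Fin m × Fin m} → VertexDisjoint p q → VertexDisjoint q p
  VertexDisjoint-sym (x≢u , x≢w , y≢u , y≢w) = x≢u ∘ sym , y≢u ∘ sym , x≢w ∘ sym , y≢w ∘ sym

  Unique-vertices⇒disjoint : ∀ (M : List (Fin m × Fin m)) → Unique (vertices M) →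
                             ∀ i j → i ≢ j → VertexDisjoint (lookup M i) (lookup M j)
  Unique-vertices⇒disjoint (_ ∷ M) _ zero zero i≢j = contradiction refl i≢j
  Unique-vertices⇒disjoint (_ ∷ M) u zero (suc j) _ = fresh u (lookup∈vertices M j)
    where
    fresh : ∀ {x y u w} → Unique (x ∷ y ∷ vertices M) → u ∈ vertices M × w ∈ vertices M →
            VertexDisjoint (x , y) (u , w)
    fresh ((_ ∷ x≢) ∷ y≢ ∷ _) (u∈ , w∈) =
      ∉⇒≢ (All¬⇒¬Any x≢) u∈ , ∉⇒≢ (All¬⇒¬Any x≢) w∈ ,
      ∉⇒≢ (All¬⇒¬Any y≢) u∈ , ∉⇒≢ (All¬⇒¬Any y≢) w∈
  Unique-vertices⇒disjoint (p ∷ M) u (suc i) zero i≢j =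
    VertexDisjoint-sym (Unique-vertices⇒disjoint (p ∷ M) u zero (suc i) (i≢j ∘ sym))
  Unique-vertices⇒disjoint (_ ∷ M) (_ ∷ _ ∷ u) (suc i) (suc j) i≢j =
    Unique-vertices⇒disjoint M u i j (i≢j ∘ cong suc)

  ∈-vertices⇒incident : ∀ {v} (M : List (Fin m × Fin m)) → v ∈ vertices M → Any (Incident v) M
  ∈-vertices⇒incident (_ ∷ M) (here v≡x) = here (inj₁ v≡x)
  ∈-vertices⇒incident (_ ∷ M) (there (here v≡y)) = here (inj₂ v≡y)
  ∈-vertices⇒incident (_ ∷ M) (there (there v∈)) = there (∈-vertices⇒incident M v∈)

  perfectMatching : (_∙_ : Op₂ m) (M : List (Fin m × Fin m)) → All (IsComEdge _∙_) M →
                    Unique (vertices M) → (∀ v → v ∈ vertices M) → PerfectMatchingCom m _∙_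
  perfectMatching _ M edges u complete =
    M , edges , Unique-vertices⇒disjoint M u , λ v → ∈-vertices⇒incident M (complete v)

module Conjugation {c ℓ} (G : Group c ℓ) where

  open Group G hiding (refl; sym; trans)
  open Group G using () renaming (refl to ≈-refl; sym to ≈-sym; trans to ≈-trans)
  open GroupProperties G using (inverseˡ-unique; ⁻¹-involutive)
  open import Algebra.Solver.Monoid monoid using (solve; _⊜_; _⊕_) renaming (id to ∅)
  open import Relation.Binary.Reasoning.Setoid setoid

  Commute : Carrier → Carrier → Set ℓ
  Commute x y = x ∙ y ≈ y ∙ x

  IsSelfInverse : Carrier → Set ℓ
  IsSelfInverse x = x ∙ x ≈ ε

  conj : Carrier → Carrier → Carrier
  conj g x = (g ∙ x) ∙ g ⁻¹

  conj-homo : ∀ g x y → conj g (x ∙ y) ≈ conj g x ∙ conj g y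
  conj-homo g x y = ≈-sym (begin
    ((g ∙ x) ∙ g ⁻¹) ∙ ((g ∙ y) ∙ g ⁻¹)
      ≈⟨ solve 4 (λ g x g⁻ y → ((g ⊕ x) ⊕ g⁻) ⊕ ((g ⊕ y) ⊕ g⁻) ⊜ (g ⊕ x) ⊕ ((g⁻ ⊕ g) ⊕ (y ⊕ g⁻)))
                 ≈-refl g x (g ⁻¹) y ⟩
    (g ∙ x) ∙ ((g ⁻¹ ∙ g) ∙ (y ∙ g ⁻¹))
      ≈⟨ ∙-congˡ (∙-congʳ (inverseˡ g)) ⟩
    (g ∙ x) ∙ (ε ∙ (y ∙ g ⁻¹))
      ≈⟨ solve 4 (λ g x g⁻ y → (g ⊕ x) ⊕ (∅ ⊕ (y ⊕ g⁻)) ⊜ (g ⊕ (x ⊕ y)) ⊕ g⁻) ≈-refl g x (g ⁻¹) y ⟩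
    (g ∙ (x ∙ y)) ∙ g ⁻¹
      ∎)

  conj-ε : ∀ g → conj g ε ≈ ε
  conj-ε g = ≈-trans (∙-congʳ (identityʳ g)) (inverseʳ g)

  conj-selfInverse : ∀ g {t} → IsSelfInverse t → IsSelfInverse (conj g t)
  conj-selfInverse g {t} tt = begin
    conj g t ∙ conj g t  ≈⟨ conj-homo g t t ⟨
    conj g (t ∙ t)       ≈⟨ ∙-congʳ (∙-congˡ tt) ⟩
    conj g ε             ≈⟨ conj-ε g ⟩
    ε                    ∎

  conj-≈⇒commute : ∀ {a b t} → conj a t ≈ conj b t → Commute t (a ⁻¹ ∙ b)
  conj-≈⇒commute {a} {b} {t} eq = begin
    t ∙ (a ⁻¹ ∙ b)
      ≈⟨ ≈-trans (∙-congʳ (inverseˡ a)) (identityˡ _) ⟨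
    (a ⁻¹ ∙ a) ∙ (t ∙ (a ⁻¹ ∙ b))
      ≈⟨ solve 4 (λ a⁻ a t b → (a⁻ ⊕ a) ⊕ (t ⊕ (a⁻ ⊕ b)) ⊜ a⁻ ⊕ (((a ⊕ t) ⊕ a⁻) ⊕ b)) ≈-refl (a ⁻¹) a t b ⟩
    a ⁻¹ ∙ (conj a t ∙ b)
      ≈⟨ ∙-congˡ (∙-congʳ eq) ⟩
    a ⁻¹ ∙ (conj b t ∙ b)
      ≈⟨ solve 4 (λ a⁻ b t b⁻ → a⁻ ⊕ (((b ⊕ t) ⊕ b⁻) ⊕ b) ⊜ (a⁻ ⊕ b) ⊕ (t ⊕ (b⁻ ⊕ b)))
                 ≈-refl (a ⁻¹) b t (b ⁻¹) ⟩
    (a ⁻¹ ∙ b) ∙ (t ∙ (b ⁻¹ ∙ b))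
      ≈⟨ ∙-congˡ (≈-trans (∙-congˡ (inverseˡ b)) (identityʳ t)) ⟩
    (a ⁻¹ ∙ b) ∙ t
      ∎

  commute-⁻¹ : ∀ {x y} → Commute x y → Commute x (y ⁻¹)
  commute-⁻¹ {x} {y} xy = begin
    x ∙ y ⁻¹
      ≈⟨ ≈-trans (∙-congʳ (inverseˡ y)) (identityˡ _) ⟨
    (y ⁻¹ ∙ y) ∙ (x ∙ y ⁻¹)
      ≈⟨ solve 3 (λ y⁻ y x → (y⁻ ⊕ y) ⊕ (x ⊕ y⁻) ⊜ y⁻ ⊕ ((y ⊕ x) ⊕ y⁻)) ≈-refl (y ⁻¹) y x ⟩
    y ⁻¹ ∙ ((y ∙ x) ∙ y ⁻¹)
      ≈⟨ ∙-congˡ (∙-congʳ xy) ⟨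
    y ⁻¹ ∙ ((x ∙ y) ∙ y ⁻¹)
      ≈⟨ solve 3 (λ y⁻ x y → y⁻ ⊕ ((x ⊕ y) ⊕ y⁻) ⊜ (y⁻ ⊕ x) ⊕ (y ⊕ y⁻)) ≈-refl (y ⁻¹) x y ⟩
    (y ⁻¹ ∙ x) ∙ (y ∙ y ⁻¹)
      ≈⟨ ≈-trans (∙-congˡ (inverseʳ y)) (identityʳ _) ⟩
    y ⁻¹ ∙ x
      ∎

  selfInverse⇒⁻¹≈ : ∀ {x} → IsSelfInverse x → x ⁻¹ ≈ x
  selfInverse⇒⁻¹≈ {x} xx = ≈-sym (inverseˡ-unique x x xx)

  ≈⁻¹⇒selfInverse : ∀ {x} → x ≈ x ⁻¹ → IsSelfInverse x
  ≈⁻¹⇒selfInverse {x} x≈x⁻¹ = ≈-trans (∙-congˡ x≈x⁻¹) (inverseʳ x)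

  selfInverse-⁻¹⁻ : ∀ {x} → IsSelfInverse (x ⁻¹) → IsSelfInverse x
  selfInverse-⁻¹⁻ {x} h = ≈⁻¹⇒selfInverse (≈-trans (≈-sym (⁻¹-involutive x)) (selfInverse⇒⁻¹≈ h))

module _ {m : ℕ} {_∙_ : Op₂ m} {e : Fin m} {inv : Fin m → Fin m} (isGroup : IsGroup _≡_ _∙_ e inv) where

  open IsGroup isGroup using (inverseˡ; inverseʳ)
  group : Group 0ℓ 0ℓ
  group = record { isGroup = isGroup }
  open GroupProperties group using (∙-cancelˡ; ⁻¹-involutive)
  open Conjugation group
  open import Data.List.Membership.DecPropositional (_≟_ {m}) using (_∈?_)

  selfInverses : List (Fin m)
  selfInverses = e ∷ filter (isInvolution? _∙_ e) (allFin m)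

  ∈-selfInverses⁺ : ∀ {x} → IsSelfInverse x → x ∈ selfInverses
  ∈-selfInverses⁺ {x} xx with x ≟ e
  ... | yes x≡e = here x≡e
  ... | no x≢e = there (∈-filter⁺ (isInvolution? _∙_ e) (∈-allFin x) (x≢e , xx))

  ∈-selfInverses⁻ : ∀ {x} → x ∈ selfInverses → IsSelfInverse x
  ∈-selfInverses⁻ (here refl) = IsGroup.identityˡ isGroup e
  ∈-selfInverses⁻ (there x∈) = proj₂ (proj₂ (∈-filter⁻ (isInvolution? _∙_ e) {xs = allFin m} x∈))

  selfInverses-unique : Unique selfInverses
  selfInverses-unique = ¬Any⇒All¬ _ e∉involutions ∷ Unique-filter⁺ (isInvolution? _∙_ e) (allFin⁺ m)
    where
    e∉involutions : e ∉ filter (isInvolution? _∙_ e) (allFin m)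
    e∉involutions e∈ = proj₁ (proj₂ (∈-filter⁻ (isInvolution? _∙_ e) {xs = allFin m} e∈)) refl

  selfInverse-≢ : ∀ {x y} → IsSelfInverse x → ¬ IsSelfInverse y → x ≢ y
  selfInverse-≢ xx ¬yy refl = ¬yy xx

  sameConjugates : ∀ {t s} → IsSelfInverse t → IsSelfInverse s →
                   ∀ k → k * length selfInverses * length selfInverses < m →
                   ∃ λ Φ → Unique Φ × k < length Φ ×
                           ∃₂ λ u v → All (λ g → conj g t ≡ u × conj g s ≡ v) Φ
  sameConjugates {t} {s} tt ss k bound =
    let u , big = pigeonhole _≟_ (conjugate t) (k * length selfInverses) selfInverses (allFin m)
                    (λ _ → conjugate-selfInverse tt) (<-≤-trans bound (≤-reflexive (sym (length-allFin m))))
        Φ₁ : List (Fin m)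
        Φ₁ = fibre _≟_ (conjugate t) u (allFin m)
        v , bigger = pigeonhole _≟_ (conjugate s) k selfInverses Φ₁ (λ _ → conjugate-selfInverse ss) big
    in fibre _≟_ (conjugate s) v Φ₁ , Unique-filter⁺ _ (Unique-filter⁺ _ (allFin⁺ m)) , bigger , u , v ,
       All.zip (All-filter⁺ _ (all-filter _ (allFin m)) , all-filter _ Φ₁)
    where
    conjugate : Fin m → Fin m → Fin m
    conjugate x g = conj g x
    conjugate-selfInverse : ∀ {x g} → IsSelfInverse x → conjugate x g ∈ selfInverses
    conjugate-selfInverse {g = g} xx = ∈-selfInverses⁺ (conj-selfInverse g xx)

  commonCentraliser : ∀ {t s} → IsSelfInverse t → IsSelfInverse s →
                      ∀ k → k * length selfInverses * length selfInverses < m →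
                      ∃ λ Y → Unique Y × k < length Y × All (λ y → Commute t y × Commute s y) Y
  commonCentraliser tt ss k bound with sameConjugates tt ss k bound
  ... | [] , _ , () , _
  ... | a ∷ Φ , Φ-unique , big , u , v , same@((at≡u , as≡v) ∷ _) =
    map (inv a ∙_) (a ∷ Φ) , Unique-map⁺ (∙-cancelˡ (inv a) _ _) Φ-unique ,
    subst (k <_) (sym (length-map _ (a ∷ Φ))) big ,
    map⁺ (All.map (λ (gt≡u , gs≡v) → conj-≈⇒commute (trans at≡u (sym gt≡u)) ,
                                 conj-≈⇒commute (trans as≡v (sym gs≡v))) same)

  freshCommonCommutant : ∀ {t s} (V : List (Fin m)) → IsSelfInverse t → IsSelfInverse s →
                         length V ≤ 2 * length selfInverses →
                         3 * length selfInverses * length selfInverses * length selfInverses < m →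
                         ∃ λ y → Commute t y × Commute s y × ¬ IsSelfInverse y × y ∉ V
  freshCommonCommutant V tt ss V-small bound =
    let Y , Y-unique , Y-large , Y-commutes = commonCentraliser tt ss (3 * length selfInverses) bound
        y , y∈Y , y∉avoided = length<⇒∃∉ _≟_ Y-unique (≤-<-trans avoided-small Y-large)
    in y , proj₁ (All.lookup Y-commutes y∈Y) , proj₂ (All.lookup Y-commutes y∈Y) ,
       (λ yy → y∉avoided (∈-++⁺ˡ (∈-selfInverses⁺ yy))) ,
       (λ y∈V → y∉avoided (∈-++⁺ʳ selfInverses y∈V))
    where
    avoided-small : length (selfInverses ++ V) ≤ 3 * length selfInverses
    avoided-small = ≤-trans (≤-reflexive (length-++ selfInverses))
                            (+-monoʳ-≤ (length selfInverses) V-small)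

  Covered : List (Fin m × Fin m) → List (Fin m) → Fin m → Set
  Covered M R v = v ∈ R ⊎ v ∈ vertices M

  record PartialMatching (M : List (Fin m × Fin m)) (R : List (Fin m)) : Set where
    field
      edges : All (IsComEdge _∙_) M
      vertices-unique : Unique (vertices M)
      pending-unique : Unique R
      pending-fresh : ∀ {x} → x ∈ R → x ∉ vertices M
      inv-closed : ∀ {x} → x ∈ vertices M → inv x ∈ vertices M
      pending-selfInverse : ∀ {x} → x ∈ R → IsSelfInverse x
      selfInverses-covered : ∀ {x} → IsSelfInverse x → Covered M R x
  open PartialMatching

  ⁻¹∉vertices : ∀ {M R x} → PartialMatching M R → x ∉ vertices M → inv x ∉ vertices M
  ⁻¹∉vertices {M} {x = x} pm x∉V x⁻¹∈V =
    x∉V (subst (_∈ vertices M) (⁻¹-involutive x) (inv-closed pm x⁻¹∈V))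

  Covered-matchPair : ∀ {M t s R y x} → Covered M (t ∷ s ∷ R) x → Covered ((t , y) ∷ (s , inv y) ∷ M) R x
  Covered-matchPair (inj₁ (here refl)) = inj₂ (here refl)
  Covered-matchPair (inj₁ (there (here refl))) = inj₂ (there (there (here refl)))
  Covered-matchPair (inj₁ (there (there x∈R))) = inj₁ x∈R
  Covered-matchPair (inj₂ x∈V) = inj₂ (there (there (there (there x∈V))))

  addInversePair : ∀ {M R x} → PartialMatching M R → ¬ Covered M R x → PartialMatching ((x , inv x) ∷ M) R
  addInversePair {M} {R} {x} pm uncovered = record
    { edges = (x∉S ∘ ≈⁻¹⇒selfInverse , trans (inverseʳ x) (sym (inverseˡ x))) ∷ edges pm
    ; vertices-unique =
        (x∉S ∘ ≈⁻¹⇒selfInverse ∷ ¬Any⇒All¬ _ x∉V) ∷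
        ¬Any⇒All¬ _ (⁻¹∉vertices pm x∉V) ∷
        vertices-unique pm
    ; pending-unique = pending-unique pm
    ; pending-fresh = λ r∈R → All¬⇒¬Any (
        selfInverse-≢ (pending-selfInverse pm r∈R) x∉S ∷
        selfInverse-≢ (pending-selfInverse pm r∈R) (x∉S ∘ selfInverse-⁻¹⁻) ∷
        ¬Any⇒All¬ _ (pending-fresh pm r∈R))
    ; inv-closed = λ
        { (here refl) → there (here refl)
        ; (there (here refl)) → here (⁻¹-involutive x)
        ; (there (there v∈V)) → there (there (inv-closed pm v∈V)) }
    ; pending-selfInverse = pending-selfInverse pm
    ; selfInverses-covered = map₂ (there ∘ there) ∘ selfInverses-covered pm
    }
    where
    x∉S : ¬ IsSelfInverse x
    x∉S = uncovered ∘ selfInverses-covered pm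
    x∉V : x ∉ vertices M
    x∉V = uncovered ∘ inj₂

  matchPair : ∀ {M t s R y} → PartialMatching M (t ∷ s ∷ R) →
              Commute t y → Commute s y → ¬ IsSelfInverse y → y ∉ vertices M →
              PartialMatching ((t , y) ∷ (s , inv y) ∷ M) R
  matchPair {M} {t} {s} {R} {y} pm ty sy y∉S y∉V = record
    { edges = (selfInverse-≢ tt y∉S , ty) ∷ (selfInverse-≢ ss y⁻¹∉S , commute-⁻¹ sy) ∷ edges pm
    ; vertices-unique =
        (selfInverse-≢ tt y∉S ∷ All.head t≢sR ∷ selfInverse-≢ tt y⁻¹∉S ∷
          ¬Any⇒All¬ _ (pending-fresh pm (here refl))) ∷
        (selfInverse-≢ ss y∉S ∘ sym ∷ y∉S ∘ ≈⁻¹⇒selfInverse ∷ ¬Any⇒All¬ _ y∉V) ∷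
        (selfInverse-≢ ss y⁻¹∉S ∷ ¬Any⇒All¬ _ (pending-fresh pm (there (here refl)))) ∷
        ¬Any⇒All¬ _ (⁻¹∉vertices pm y∉V) ∷
        vertices-unique pm
    ; pending-unique = AllPairs.tail (AllPairs.tail (pending-unique pm))
    ; pending-fresh = λ r∈R → All¬⇒¬Any (
        (All.lookup t≢sR (there r∈R) ∘ sym) ∷ selfInverse-≢ (rr r∈R) y∉S ∷
        (All.lookup s≢R r∈R ∘ sym) ∷ selfInverse-≢ (rr r∈R) y⁻¹∉S ∷
        ¬Any⇒All¬ _ (pending-fresh pm (there (there r∈R))))
    ; inv-closed = λ
        { (here refl) → here (selfInverse⇒⁻¹≈ tt)
        ; (there (here refl)) → there (there (there (here refl)))
        ; (there (there (here refl))) → there (there (here (selfInverse⇒⁻¹≈ ss)))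
        ; (there (there (there (here refl)))) → there (here (⁻¹-involutive y))
        ; (there (there (there (there v∈V)))) → there (there (there (there (inv-closed pm v∈V)))) }
    ; pending-selfInverse = rr
    ; selfInverses-covered = Covered-matchPair ∘ selfInverses-covered pm
    }
    where
    tt : IsSelfInverse t
    tt = pending-selfInverse pm (here refl)
    ss : IsSelfInverse s
    ss = pending-selfInverse pm (there (here refl))
    rr : ∀ {r} → r ∈ R → IsSelfInverse r
    rr = pending-selfInverse pm ∘ there ∘ there
    y⁻¹∉S : ¬ IsSelfInverse (inv y)
    y⁻¹∉S = y∉S ∘ selfInverse-⁻¹⁻
    t≢sR : All (t ≢_) (s ∷ R)
    t≢sR = AllPairs.head (pending-unique pm)
    s≢R : All (s ≢_) R
    s≢R = AllPairs.head (AllPairs.tail (pending-unique pm))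

  skipCovered : ∀ {M R x xs v} → Covered M R x → v ∈ x ∷ xs ⊎ Covered M R v → v ∈ xs ⊎ Covered M R v
  skipCovered x-covered (inj₁ (here refl)) = inj₂ x-covered
  skipCovered _ (inj₁ (there v∈xs)) = inj₁ v∈xs
  skipCovered _ (inj₂ v-covered) = inj₂ v-covered

  coverByInversePairs : ∀ (xs : List (Fin m)) {M R} → PartialMatching M R →
                        (∀ v → v ∈ xs ⊎ Covered M R v) →
                        ∃ λ M′ → PartialMatching M′ R × (∀ v → Covered M′ R v)
  coverByInversePairs [] pm covered = _ , pm , [ (λ ()) , id ] ∘ covered
  coverByInversePairs (x ∷ xs) {M} {R} pm covered with (x ∈? R) ⊎-dec (x ∈? vertices M)
  ... | yes x-covered = coverByInversePairs xs pm (skipCovered x-covered ∘ covered)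
  ... | no x-uncovered = coverByInversePairs xs (addInversePair pm x-uncovered)
                           (skipCovered (inj₂ (here refl)) ∘ map₂ (map₂ (there ∘ there)) ∘ covered)

  singlePending⇒odd : ∀ {M t} → PartialMatching M (t ∷ []) → (∀ v → Covered M (t ∷ []) v) → ¬ 2 ∣ m
  singlePending⇒odd {M} {t} pm covered (divides q m≡q*2) = even≢odd q (length M) (begin
    2 * q                    ≡⟨ *-comm 2 q ⟩
    q * 2                    ≡⟨ m≡q*2 ⟨
    m                        ≡⟨ Unique-complete⇒length≡ t∷V-unique complete ⟨
    length (t ∷ vertices M)  ≡⟨ cong suc (length-vertices M) ⟩
    suc (2 * length M)       ∎)
    where
    open ≡-Reasoning
    t∷V-unique : Unique (t ∷ vertices M)
    t∷V-unique = ¬Any⇒All¬ _ (pending-fresh pm (here refl)) ∷ vertices-unique pm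
    complete : ∀ v → v ∈ t ∷ vertices M
    complete = [ (λ { (here v≡t) → here v≡t }) , there ] ∘ covered

  emptyMatching : PartialMatching [] selfInverses
  emptyMatching = record
    { edges = []
    ; vertices-unique = []
    ; pending-unique = selfInverses-unique
    ; pending-fresh = λ _ ()
    ; inv-closed = λ ()
    ; pending-selfInverse = ∈-selfInverses⁻
    ; selfInverses-covered = inj₁ ∘ ∈-selfInverses⁺
    }

  -- The size invariant keeps the vertices matched so far below 2|S|.
  matchSelfInverses : 2 ∣ m → 3 * length selfInverses * length selfInverses * length selfInverses < m →
                      ∀ {M} R → PartialMatching M R →
                      length (vertices M) + 2 * length R ≡ 2 * length selfInverses → PerfectMatchingCom m _∙_
  matchSelfInverses _ _ [] pm _ with coverByInversePairs (allFin m) pm (inj₁ ∘ ∈-allFin)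
  ... | M′ , pm′ , covered =
    perfectMatching _∙_ M′ (edges pm′) (vertices-unique pm′) ([ (λ ()) , id ] ∘ covered)
  matchSelfInverses even _ (_ ∷ []) pm _ with coverByInversePairs (allFin m) pm (inj₁ ∘ ∈-allFin)
  ... | _ , pm′ , covered = contradiction even (singlePending⇒odd pm′ covered)
  matchSelfInverses even bound {M} (_ ∷ _ ∷ R) pm size =
    let y , ty , sy , y∉S , y∉V = freshCommonCommutant (vertices M) (pending-selfInverse pm (here refl))
                                    (pending-selfInverse pm (there (here refl)))
                                    (subst (length (vertices M) ≤_) size (m≤m+n _ _)) bound
    in matchSelfInverses even bound R (matchPair pm ty sy y∉S y∉V)
         (trans (shift (length (vertices M)) (length R)) size)
    where
    shift : ∀ v r → 4 + v + 2 * r ≡ v + 2 * (2 + r)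
    shift = solve-∀

involutionBound : ℕ → ℕ
involutionBound n = suc (3 * suc n * suc n * suc n)

mainTheorem9 : Σ (ℕ → ℕ) λ F →
    ∀ (m : ℕ) (_∙_ : Fin m → Fin m → Fin m) (e : Fin m) (inv : Fin m → Fin m) →
      IsGroup (_≡_ {A = Fin m}) _∙_ e inv →
      2 ∣ m →
      ∀ (n : ℕ) → numInvolutions _∙_ e ≡ n →
      F n ≤ m →
      PerfectMatchingCom m _∙_
mainTheorem9 = involutionBound , λ { m _∙_ e inv isGroup even n refl bound →
  matchSelfInverses isGroup even bound (selfInverses isGroup) (emptyMatching isGroup) refl }
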